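{- Let $N\in\mathbb N$ and let $q=(q_1,q_2,q_3)\in M$ satisfy $3(q_1^2+q_2^2+q_1q_2)-2q_1-q_2=N$. Then: (1) $\{R^k p(q):k=1,\dots,6\}=\bigsqcup_{i=0}^{2}\{p(\omega_i+M_i(q)),\,-p(\omega_i+M_i(q))\}$ (a disjoint union); (2) $\mathcal U(12N+4)=\bigsqcup \{p(\omega_i+M_i(r)),\,-p(\omega_i+M_i(r))\}$, where the disjoint union runs over all pairs $(i,r)$ with $i\in\{0,1,2\}$, $r\in M$ and $3(r_1^2+r_2^2+r_1r_2)-2r_1-r_2=N$.
   Context: Type $A_2^{(1)}$. $M=\{(q_1,q_2,q_3)\in\mathbb Z^3: q_1+q_2+q_3=0\}$. $\omega_0=0$, $\omega_1=(\tfrac23,-\tfrac13,-\tfrac13)$, $\omega_2=(\tfrac13,\tfrac13,-\tfrac23)$; $M_0=\mathrm{id}$, $M_1(x_1,x_2,x_3)=(x_3,x_1,x_2)$, $M_2(x_1,x_2,x_3)=(x_2,x_3,x_1)$. $p:\mathbb R^3\to\mathbb R^2$, $p(x,y,z)=(3x+6y-1,\,3x-1)$. $R=\frac12\begin{pmatrix}1&-3\\1&1\end{pmatrix}$. $\mathcal U(k)=\{(x,y)\in\mathbb Z^2: x^2+3y^2=k\}$. Interpretation from the paper: the elements $q\in M$ with $3(q_1^2+q_2^2+q_1q_2)-2q_1-q_2=N$ are exactly the translation parts $q$ of the affine Grassmannian elements $w=t_q\overline w$ (minimal length representatives of $W/W_0$) of $\Lambda_0$-atomic length $N$ (equivalently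 $3$-cores of size $N$); the extended affine Grassmannian elements $\sigma_i w$, $\sigma_i=t_{\omega_i}w_{0,i}w_0$, have translation part $\omega_i+M_i(q)$; the sets in (1),(2) are the paper's orbits $\widehat O_N(\sigma_iw)$ and the index set in (2) is its set $\widehat{\mathcal B}(N)$. -}

module Defs where

open import Data.Nat as ℕ using (ℕ; zero; suc)
open import Data.Integer as ℤ using (ℤ; +_)
open import Data.Rational as ℚ using (ℚ; _/_)
open import Data.Fin using (Fin; zero; suc)
open import Data.Product using (_×_; _,_)
open import Data.Sum using (_⊎_)
open import Relation.Binary.PropositionalEquality using (_≡_)

ℤ³ : Set
ℤ³ = ℤ × ℤ × ℤ

ℚ³ : Set
ℚ³ = ℚ × ℚ × ℚ

ℚ² : Set
ℚ² = ℚ × ℚ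

ι : ℤ → ℚ
ι z = z / 1

ι³ : ℤ³ → ℚ³
ι³ (a , b , c) = ι a , ι b , ι c

ι² : ℤ × ℤ → ℚ²
ι² (a , b) = ι a , ι b

InM : ℤ³ → Set
InM (q₁ , q₂ , q₃) = q₁ ℤ.+ q₂ ℤ.+ q₃ ≡ + 0

atomicLength : ℤ³ → ℤ
atomicLength (q₁ , q₂ , q₃) =
  + 3 ℤ.* (q₁ ℤ.* q₁ ℤ.+ q₂ ℤ.* q₂ ℤ.+ q₁ ℤ.* q₂) ℤ.- + 2 ℤ.* q₁ ℤ.- q₂

ω : Fin 3 → ℚ³
ω zero = ℚ.0ℚ , ℚ.0ℚ , ℚ.0ℚ
ω (suc zero) = + 2 / 3 , ℚ.- (+ 1 / 3) , ℚ.- (+ 1 / 3)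
ω (suc (suc zero)) = + 1 / 3 , + 1 / 3 , ℚ.- (+ 2 / 3)

Mmap : Fin 3 → ℚ³ → ℚ³
Mmap zero x = x
Mmap (suc zero) (x₁ , x₂ , x₃) = x₃ , x₁ , x₂
Mmap (suc (suc zero)) (x₁ , x₂ , x₃) = x₂ , x₃ , x₁

_+³_ : ℚ³ → ℚ³ → ℚ³
(a₁ , a₂ , a₃) +³ (b₁ , b₂ , b₃) = a₁ ℚ.+ b₁ , a₂ ℚ.+ b₂ , a₃ ℚ.+ b₃

p : ℚ³ → ℚ²
p (x , y , z) = ι (+ 3) ℚ.* x ℚ.+ ι (+ 6) ℚ.* y ℚ.- ℚ.1ℚ , ι (+ 3) ℚ.* x ℚ.- ℚ.1ℚ

R : ℚ² → ℚ²
R (x , y) = ℚ.½ ℚ.* (x ℚ.- ι (+ 3) ℚ.* y) , ℚ.½ ℚ.* (x ℚ.+ y)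

Rpow : ℕ → ℚ² → ℚ²
Rpow zero v = v
Rpow (suc k) v = R (Rpow k v)

neg² : ℚ² → ℚ²
neg² (x , y) = ℚ.- x , ℚ.- y

InPair : ℚ² → ℚ² → Set
InPair a v = v ≡ a ⊎ v ≡ neg² a

-- p(ω_i + M_i(q)), the image of the translation part of σ_i w
P : Fin 3 → ℤ³ → ℚ²
P i q = p (ω i +³ Mmap i (ι³ q))

InU : ℕ → ℤ × ℤ → Set
InU k (x , y) = x ℤ.* x ℤ.+ + 3 ℤ.* (y ℤ.* y) ≡ + k

-- In the coordinates (y , k) with x = y + 2k, which cover exactly the points with x ≡ y (mod 2),
-- R acts as the rotation ρ(y , k) = (y + k , -y): an integral map of order 6 with ρ³ = -1,
-- preserving the Eisenstein norm y² + yk + k², and x² + 3y² = 4(y² + yk + k²).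
-- For q = (a , b , -a-b) ∈ M the point p(q) has coordinates (3a - 1 , 3b) and Eisenstein norm
-- 3·atomicLength(q) + 1, and p(ωᵢ + Mᵢ(q)) = R^(6-2i) p(q); as R³ = -1, the six points
-- ±p(ωᵢ + Mᵢ(q)) are exactly the R-orbit of p(q). Since ρ(3u + e) = 3ρ(u) + ρ(e), reduction mod 3
-- shows that ρ permutes the six residue classes of (y , k) with y ≢ k cyclically; hence the point
-- R^n p(q) determines n mod 6, and then q, which gives both disjointness statements. Conversely,
-- a solution of x² + 3y² = 12N + 4 has x ≡ y (mod 2) and Eisenstein norm 3N + 1, so y ≢ k (mod 3)
-- and it is R^n p(q) for some n and some q of atomic length N.

module Submission where

open import Defs
open import Data.Nat as ℕ using (ℕ; suc)
open import Data.Integer as ℤ using (ℤ; +_)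
open import Data.Fin using (Fin; toℕ; zero)
open import Data.Product using (_×_; _,_; ∃; ∃-syntax; ∃₂; proj₁; proj₂)
open import Data.Sum using (_⊎_; inj₁; inj₂)
open import Relation.Nullary using (¬_)
open import Relation.Binary.PropositionalEquality
  using (_≡_; _≢_; refl; sym; trans; cong; cong₂; subst; subst₂; module ≡-Reasoning)
open ≡-Reasoning

open import Data.Empty using (⊥-elim)
open import Data.Fin using (suc; #_)
open import Data.Integer using (-[1+_]; _+_; _*_; _-_; -_; ∣_∣; 0ℤ)
open import Data.Integer.DivMod using (_%ℕ_; _/ℕ_; n%ℕd<d; a≡a%ℕn+[a/ℕn]*n)
import Data.Integer.Properties as ℤP
open import Data.Integer.Tactic.RingSolver using (solve)
open import Data.List using (_∷_; [])
open import Data.Nat.Coprimality using (gcd≡1⇒coprime)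
open import Data.Nat.DivMod using (_mod_)
open import Data.Nat.GCD using (gcd-zeroʳ)
import Data.Nat.Properties as ℕP
open import Data.Rational as ℚ using (ℚ; mkℚ; ↥_)
import Data.Rational.Properties as ℚP
open import Function using (_∘_)
open import Function.Definitions using (Injective)

fromℤ : ℤ → ℚ
fromℤ z = mkℚ z 0 (gcd≡1⇒coprime (gcd-zeroʳ ∣ z ∣))

-- The arithmetic of ℚ computes on fromℤ, so the homomorphism laws hold by unfolding.
ι≡fromℤ : ∀ z → ι z ≡ fromℤ z
ι≡fromℤ z = ℚP.↥p/↧p≡p (fromℤ z)

ι-injective : Injective _≡_ _≡_ ι
ι-injective {x} {y} eq = cong ↥_ (trans (sym (ι≡fromℤ x)) (trans eq (ι≡fromℤ y)))

ι-homo-+ : ∀ x y → ι (x + y) ≡ ι x ℚ.+ ι y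
ι-homo-+ x y = begin
  ι (x + y)                 ≡⟨ cong₂ (λ s t → ι (s + t)) (sym (ℤP.*-identityʳ x)) (sym (ℤP.*-identityʳ y)) ⟩
  fromℤ x ℚ.+ fromℤ y       ≡⟨ sym (cong₂ ℚ._+_ (ι≡fromℤ x) (ι≡fromℤ y)) ⟩
  ι x ℚ.+ ι y               ∎

ι-homo-* : ∀ x y → ι (x * y) ≡ ι x ℚ.* ι y
ι-homo-* x y = sym (cong₂ ℚ._*_ (ι≡fromℤ x) (ι≡fromℤ y))

fromℤ-homo-neg : ∀ z → fromℤ (- z) ≡ ℚ.- fromℤ z
fromℤ-homo-neg (+ 0)      = refl
fromℤ-homo-neg (+ suc n)  = refl
fromℤ-homo-neg -[1+ n ]   = refl

ι-homo-neg : ∀ z → ι (- z) ≡ ℚ.- ι z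
ι-homo-neg z = trans (ι≡fromℤ (- z)) (trans (fromℤ-homo-neg z) (cong ℚ.-_ (sym (ι≡fromℤ z))))

ι-homo-sub : ∀ x y → ι (x - y) ≡ ι x ℚ.- ι y
ι-homo-sub x y = trans (ι-homo-+ x (- y)) (cong (ι x ℚ.+_) (ι-homo-neg y))

ℤ² : Set
ℤ² = ℤ × ℤ

ι²-injective : Injective _≡_ _≡_ ι²
ι²-injective eq = cong₂ _,_ (ι-injective (cong proj₁ eq)) (ι-injective (cong proj₂ eq))

iterate : {A : Set} → (A → A) → ℕ → A → A
iterate f ℕ.zero x = x
iterate f (suc n) x = f (iterate f n x)

iterate-injective : {A : Set} {f : A → A} → Injective _≡_ _≡_ f →
                    ∀ n → Injective _≡_ _≡_ (iterate f n)
iterate-injective f-inj ℕ.zero    eq = eq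
iterate-injective f-inj (suc n)   eq = iterate-injective f-inj n (f-inj eq)

iterate-surjective : {A : Set} {f : A → A} → (∀ y → ∃ λ x → f x ≡ y) →
                     ∀ n y → ∃ λ x → iterate f n x ≡ y
iterate-surjective f-surj ℕ.zero  y = y , refl
iterate-surjective {f = f} f-surj (suc n) y with f-surj y
... | x , fx≡y with iterate-surjective f-surj n x
...   | x' , fⁿx'≡x = x' , trans (cong f fⁿx'≡x) fx≡y

∣n*w∣<n⇒w≡0 : ∀ n w → ∣ + n * w ∣ ℕ.< n → w ≡ 0ℤ
∣n*w∣<n⇒w≡0 n w small =
  ℤP.∣i∣≡0⇒i≡0 (ℕP.n<1⇒n≡0 (ℕP.*-cancelˡ-< n ∣ w ∣ 1 n∣w∣<n*1))
  where
  n∣w∣<n*1 : n ℕ.* ∣ w ∣ ℕ.< n ℕ.* 1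
  n∣w∣<n*1 = subst₂ ℕ._<_ (ℤP.abs-* (+ n) w) (sym (ℕP.*-identityʳ n)) small

difference-of-expansions : ∀ m u u' r r' → m * u + r ≡ m * u' + r' → m * (u - u') ≡ r' - r
difference-of-expansions m u u' r r' eq = begin
  m * (u - u')                                 ≡⟨ solve (m ∷ u ∷ u' ∷ r ∷ r' ∷ []) ⟩
  (m * u + r) - (m * u' + r') + (r' - r)       ≡⟨ cong (λ t → t - (m * u' + r') + (r' - r)) eq ⟩
  (m * u' + r') - (m * u' + r') + (r' - r)     ≡⟨ solve (m ∷ u' ∷ r ∷ r' ∷ []) ⟩
  r' - r                                       ∎

remainder-unique : ∀ n {u u' r r'} → + n * u + r ≡ + n * u' + r' →
                   ∣ r' - r ∣ ℕ.< n → u ≡ u' × r ≡ r'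
remainder-unique n {u} {u'} {r} {r'} eq gap = ℤP.i-j≡0⇒i≡j u u' u-u'≡0 , sym (ℤP.i-j≡0⇒i≡j r' r r'-r≡0)
  where
  shift : + n * (u - u') ≡ r' - r
  shift = difference-of-expansions (+ n) u u' r r' eq
  u-u'≡0 : u - u' ≡ 0ℤ
  u-u'≡0 = ∣n*w∣<n⇒w≡0 n (u - u') (subst (λ c → ∣ c ∣ ℕ.< n) (sym shift) gap)
  r'-r≡0 : r' - r ≡ 0ℤ
  r'-r≡0 = trans (sym shift) (trans (cong (+ n *_) u-u'≡0) (ℤP.*-zeroʳ (+ n)))

parityExpansion : ∀ z → ∃ λ k → z ≡ + 2 * k ⊎ z ≡ + 2 * k + + 1
parityExpansion z = fromRemainder (z %ℕ 2) (z /ℕ 2) (n%ℕd<d z 2) (a≡a%ℕn+[a/ℕn]*n z 2)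
  where
  fromRemainder : ∀ r q → r ℕ.< 2 → z ≡ + r + q * + 2 → ∃ λ k → z ≡ + 2 * k ⊎ z ≡ + 2 * k + + 1
  fromRemainder 0 q _ eq = q , inj₁ (trans eq (solve (q ∷ [])))
  fromRemainder 1 q _ eq = q , inj₂ (trans eq (solve (q ∷ [])))
  fromRemainder (suc (suc _)) _ (ℕ.s≤s (ℕ.s≤s ())) _

-- Balanced ternary digits

data Digit : Set where
  d⁻ d⁰ d⁺ : Digit

⟦_⟧ᵈ : Digit → ℤ
⟦ d⁻ ⟧ᵈ = -[1+ 0 ]
⟦ d⁰ ⟧ᵈ = + 0
⟦ d⁺ ⟧ᵈ = + 1

∣⟦⟧ᵈ∣≤1 : ∀ d → ∣ ⟦ d ⟧ᵈ ∣ ℕ.≤ 1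
∣⟦⟧ᵈ∣≤1 d⁻ = ℕP.≤-refl
∣⟦⟧ᵈ∣≤1 d⁰ = ℕ.z≤n
∣⟦⟧ᵈ∣≤1 d⁺ = ℕP.≤-refl

⟦⟧ᵈ-injective : Injective _≡_ _≡_ ⟦_⟧ᵈ
⟦⟧ᵈ-injective {d⁻} {d⁻} _ = refl
⟦⟧ᵈ-injective {d⁰} {d⁰} _ = refl
⟦⟧ᵈ-injective {d⁺} {d⁺} _ = refl
⟦⟧ᵈ-injective {d⁻} {d⁰} ()
⟦⟧ᵈ-injective {d⁻} {d⁺} ()
⟦⟧ᵈ-injective {d⁰} {d⁻} ()
⟦⟧ᵈ-injective {d⁰} {d⁺} ()
⟦⟧ᵈ-injective {d⁺} {d⁻} ()
⟦⟧ᵈ-injective {d⁺} {d⁰} ()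

digit-unique : ∀ {u u' d d'} → + 3 * u + ⟦ d ⟧ᵈ ≡ + 3 * u' + ⟦ d' ⟧ᵈ → u ≡ u' × d ≡ d'
digit-unique {u} {u'} {d} {d'} eq = proj₁ unique , ⟦⟧ᵈ-injective (proj₂ unique)
  where
  gap≤2 : ∣ ⟦ d' ⟧ᵈ - ⟦ d ⟧ᵈ ∣ ℕ.≤ 2
  gap≤2 = ℕP.≤-trans (ℤP.∣i-j∣≤∣i∣+∣j∣ ⟦ d' ⟧ᵈ ⟦ d ⟧ᵈ) (ℕP.+-mono-≤ (∣⟦⟧ᵈ∣≤1 d') (∣⟦⟧ᵈ∣≤1 d))
  unique : u ≡ u' × ⟦ d ⟧ᵈ ≡ ⟦ d' ⟧ᵈ
  unique = remainder-unique 3 {u} {u'} {⟦ d ⟧ᵈ} {⟦ d' ⟧ᵈ} eq (ℕ.s≤s gap≤2)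

digitExpansion : ∀ z → ∃₂ λ u d → z ≡ + 3 * u + ⟦ d ⟧ᵈ
digitExpansion z = fromRemainder (z %ℕ 3) (z /ℕ 3) (n%ℕd<d z 3) (a≡a%ℕn+[a/ℕn]*n z 3)
  where
  fromRemainder : ∀ r q → r ℕ.< 3 → z ≡ + r + q * + 3 → ∃₂ λ u d → z ≡ + 3 * u + ⟦ d ⟧ᵈ
  fromRemainder 0 q _ eq = q , d⁰ , trans eq (solve (q ∷ []))
  fromRemainder 1 q _ eq = q , d⁺ , trans eq (solve (q ∷ []))
  fromRemainder 2 q _ eq = q + + 1 , d⁻ , trans eq (solve (q ∷ []))
  fromRemainder (suc (suc (suc _))) _ (ℕ.s≤s (ℕ.s≤s (ℕ.s≤s ()))) _

withDigits : ℤ² → Digit × Digit → ℤ²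
withDigits (U , V) (d₁ , d₂) = + 3 * U + ⟦ d₁ ⟧ᵈ , + 3 * V + ⟦ d₂ ⟧ᵈ

withDigits-injective : ∀ {u u' d d'} → withDigits u d ≡ withDigits u' d' → u ≡ u' × d ≡ d'
withDigits-injective {U , V} {U' , V'} {d₁ , d₂} {d₁' , d₂'} eq =
  cong₂ _,_ (proj₁ first) (proj₁ second) , cong₂ _,_ (proj₂ first) (proj₂ second)
  where
  first : U ≡ U' × d₁ ≡ d₁'
  first = digit-unique {U} {U'} {d₁} {d₁'} (cong proj₁ eq)
  second : V ≡ V' × d₂ ≡ d₂'
  second = digit-unique {V} {V'} {d₂} {d₂'} (cong proj₂ eq)

withDigits-expansion : ∀ w → ∃₂ λ u d → w ≡ withDigits u d
withDigits-expansion (y , k) with digitExpansion y | digitExpansion k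
... | U , d₁ , y≡ | V , d₂ , k≡ = (U , V) , (d₁ , d₂) , cong₂ _,_ y≡ k≡

-- The rotation ρ

lattice : ℤ² → ℤ²
lattice (y , k) = y + + 2 * k , y

ρ : ℤ² → ℤ²
ρ (y , k) = y + k , - y

ρ^ : ℕ → ℤ² → ℤ²
ρ^ = iterate ρ

half-double : ∀ z → ℚ.½ ℚ.* ι (+ 2 * z) ≡ ι z
half-double z = begin
  ℚ.½ ℚ.* ι (+ 2 * z)           ≡⟨ cong (ℚ.½ ℚ.*_) (ι-homo-* (+ 2) z) ⟩
  ℚ.½ ℚ.* (ι (+ 2) ℚ.* ι z)     ≡⟨ sym (ℚP.*-assoc ℚ.½ (ι (+ 2)) (ι z)) ⟩
  ℚ.1ℚ ℚ.* ι z                  ≡⟨ ℚP.*-identityˡ (ι z) ⟩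
  ι z                           ∎

R-ι² : ∀ x y x' y' → x - + 3 * y ≡ + 2 * x' → x + y ≡ + 2 * y' →
       R (ι x , ι y) ≡ (ι x' , ι y')
R-ι² x y x' y' eq₁ eq₂ = cong₂ _,_
  (begin
    ℚ.½ ℚ.* (ι x ℚ.- ι (+ 3) ℚ.* ι y)  ≡⟨ cong (λ t → ℚ.½ ℚ.* (ι x ℚ.- t)) (sym (ι-homo-* (+ 3) y)) ⟩
    ℚ.½ ℚ.* (ι x ℚ.- ι (+ 3 * y))      ≡⟨ cong (ℚ.½ ℚ.*_) (sym (ι-homo-sub x (+ 3 * y))) ⟩
    ℚ.½ ℚ.* ι (x - + 3 * y)            ≡⟨ cong (λ t → ℚ.½ ℚ.* ι t) eq₁ ⟩
    ℚ.½ ℚ.* ι (+ 2 * x')               ≡⟨ half-double x' ⟩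
    ι x'                               ∎)
  (begin
    ℚ.½ ℚ.* (ι x ℚ.+ ι y)              ≡⟨ cong (ℚ.½ ℚ.*_) (sym (ι-homo-+ x y)) ⟩
    ℚ.½ ℚ.* ι (x + y)                  ≡⟨ cong (λ t → ℚ.½ ℚ.* ι t) eq₂ ⟩
    ℚ.½ ℚ.* ι (+ 2 * y')               ≡⟨ half-double y' ⟩
    ι y'                               ∎)

R-lattice : ∀ w → R (ι² (lattice w)) ≡ ι² (lattice (ρ w))
R-lattice (y , k) = R-ι² (y + + 2 * k) y (y + k + + 2 * - y) (y + k)
  (solve (y ∷ k ∷ [])) (solve (y ∷ k ∷ []))

Rpow-lattice : ∀ n w → Rpow n (ι² (lattice w)) ≡ ι² (lattice (ρ^ n w))
Rpow-lattice ℕ.zero  w = refl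
Rpow-lattice (suc n) w = trans (cong R (Rpow-lattice n w)) (R-lattice (ρ^ n w))

lattice-injective : Injective _≡_ _≡_ lattice
lattice-injective {y , k} {y' , k'} eq = cong₂ _,_ y≡y' (ℤP.*-cancelˡ-≡ (+ 2) k k' 2k≡2k')
  where
  y≡y' : y ≡ y'
  y≡y' = cong proj₂ eq
  2k≡2k' : + 2 * k ≡ + 2 * k'
  2k≡2k' = begin
    + 2 * k                       ≡⟨ solve (y ∷ k ∷ []) ⟩
    (y + + 2 * k) - y             ≡⟨ cong₂ _-_ (cong proj₁ eq) y≡y' ⟩
    (y' + + 2 * k') - y'          ≡⟨ solve (y' ∷ k' ∷ []) ⟩
    + 2 * k'                      ∎

ρ-injective : Injective _≡_ _≡_ ρ
ρ-injective {y , k} {y' , k'} eq = cong₂ _,_ y≡y' (begin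
    k                  ≡⟨ solve (y ∷ k ∷ []) ⟩
    (y + k) - y        ≡⟨ cong₂ _-_ (cong proj₁ eq) y≡y' ⟩
    (y' + k') - y'     ≡⟨ solve (y' ∷ k' ∷ []) ⟩
    k'                 ∎)
  where
  y≡y' : y ≡ y'
  y≡y' = ℤP.neg-injective (cong proj₂ eq)

ρ-surjective : ∀ w → ∃ λ w' → ρ w' ≡ w
ρ-surjective (y , k) = (- k , y + k) , cong₂ _,_ (solve (y ∷ k ∷ [])) (ℤP.neg-involutive k)

ρ²-closed : ∀ a b → ρ^ 2 (a , b) ≡ (b , - (a + b))
ρ²-closed a b = begin
  ρ (a + b , - a)   ≡⟨ cong₂ _,_ (solve (a ∷ b ∷ [])) refl ⟩
  (b , - (a + b))   ∎

ρ³≡neg : ∀ y k → ρ^ 3 (y , k) ≡ (- y , - k)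
ρ³≡neg y k = begin
  ρ (ρ^ 2 (y , k))       ≡⟨ cong ρ (ρ²-closed y k) ⟩
  ρ (k , - (y + k))      ≡⟨ cong₂ _,_ (solve (y ∷ k ∷ [])) refl ⟩
  (- y , - k)            ∎

ρ⁴-closed : ∀ a b → ρ^ 4 (a , b) ≡ (- (a + b) , a)
ρ⁴-closed a b = begin
  ρ (ρ^ 3 (a , b))   ≡⟨ cong ρ (ρ³≡neg a b) ⟩
  ρ (- a , - b)      ≡⟨ cong₂ _,_ (solve (a ∷ b ∷ [])) (ℤP.neg-involutive a) ⟩
  (- (a + b) , a)    ∎

ρ⁶≡id : ∀ w → ρ^ 6 w ≡ w
ρ⁶≡id (y , k) = begin
  ρ^ 3 (ρ^ 3 (y , k))    ≡⟨ cong (ρ^ 3) (ρ³≡neg y k) ⟩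
  ρ^ 3 (- y , - k)       ≡⟨ ρ³≡neg (- y) (- k) ⟩
  (- - y , - - k)        ≡⟨ cong₂ _,_ (ℤP.neg-involutive y) (ℤP.neg-involutive k) ⟩
  (y , k)                ∎

ρ^-periodic : ∀ n w → ρ^ (n ℕ.+ 6) w ≡ ρ^ n w
ρ^-periodic ℕ.zero  w = ρ⁶≡id w
ρ^-periodic (suc n) w = cong ρ (ρ^-periodic n w)

neg²-lattice : ∀ w → neg² (ι² (lattice w)) ≡ ι² (lattice (ρ^ 3 w))
neg²-lattice (y , k) = begin
  (ℚ.- ι (y + + 2 * k) , ℚ.- ι y)   ≡⟨ cong₂ _,_ (sym (ι-homo-neg (y + + 2 * k))) (sym (ι-homo-neg y)) ⟩
  (ι (- (y + + 2 * k)) , ι (- y))   ≡⟨ cong (λ t → ι t , ι (- y)) neg-distrib ⟩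
  ι² (lattice (- y , - k))          ≡⟨ cong (ι² ∘ lattice) (sym (ρ³≡neg y k)) ⟩
  ι² (lattice (ρ^ 3 (y , k)))       ∎
  where
  neg-distrib : - (y + + 2 * k) ≡ - y + + 2 * - k
  neg-distrib = solve (y ∷ k ∷ [])

norm : ℤ² → ℤ
norm (x , y) = x * x + + 3 * (y * y)

eisensteinNorm : ℤ² → ℤ
eisensteinNorm (y , k) = y * y + y * k + k * k

norm-lattice : ∀ w → norm (lattice w) ≡ + 4 * eisensteinNorm w
norm-lattice (y , k) = begin
  (y + + 2 * k) * (y + + 2 * k) + + 3 * (y * y)  ≡⟨ solve (y ∷ k ∷ []) ⟩
  + 4 * (y * y + y * k + k * k)                  ∎

eisensteinNorm-ρ : ∀ w → eisensteinNorm (ρ w) ≡ eisensteinNorm w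
eisensteinNorm-ρ (y , k) = begin
  (y + k) * (y + k) + (y + k) * - y + - y * - y  ≡⟨ solve (y ∷ k ∷ []) ⟩
  y * y + y * k + k * k                          ∎

eisensteinNorm-ρ^ : ∀ n w → eisensteinNorm (ρ^ n w) ≡ eisensteinNorm w
eisensteinNorm-ρ^ ℕ.zero  w = refl
eisensteinNorm-ρ^ (suc n) w = trans (eisensteinNorm-ρ (ρ^ n w)) (eisensteinNorm-ρ^ n w)

-- Residues mod 3 along ρ-orbits

-- orbitDigits k are the residues mod 3 of ρ^(k + 1) (3a - 1 , 3b).
orbitDigits : Fin 6 → Digit × Digit
orbitDigits zero                                = d⁻ , d⁺
orbitDigits (suc zero)                          = d⁰ , d⁺
orbitDigits (suc (suc zero))                    = d⁺ , d⁰
orbitDigits (suc (suc (suc zero)))              = d⁺ , d⁻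
orbitDigits (suc (suc (suc (suc zero))))        = d⁰ , d⁻
orbitDigits (suc (suc (suc (suc (suc zero))))) = d⁻ , d⁰

next : Fin 6 → Fin 6
next k = suc (toℕ k) mod 6

⟦_⟧²ᵈ : Digit × Digit → ℤ²
⟦ d₁ , d₂ ⟧²ᵈ = ⟦ d₁ ⟧ᵈ , ⟦ d₂ ⟧ᵈ

-- ρ permutes the six digit vectors cyclically, without carries.
ρ-orbitDigits : ∀ k → ρ ⟦ orbitDigits k ⟧²ᵈ ≡ ⟦ orbitDigits (next k) ⟧²ᵈ
ρ-orbitDigits zero                                = refl
ρ-orbitDigits (suc zero)                          = refl
ρ-orbitDigits (suc (suc zero))                    = refl
ρ-orbitDigits (suc (suc (suc zero)))              = refl
ρ-orbitDigits (suc (suc (suc (suc zero))))        = refl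
ρ-orbitDigits (suc (suc (suc (suc (suc zero))))) = refl

ρ-linear : ∀ U V e₁ e₂ → ρ (+ 3 * U + e₁ , + 3 * V + e₂) ≡ (+ 3 * (U + V) + (e₁ + e₂) , + 3 * - U + - e₁)
ρ-linear U V e₁ e₂ = cong₂ _,_ (solve (U ∷ V ∷ e₁ ∷ e₂ ∷ [])) (solve (U ∷ e₁ ∷ []))

ρ-withDigits : ∀ u k → ρ (withDigits u (orbitDigits k)) ≡ withDigits (ρ u) (orbitDigits (next k))
ρ-withDigits (U , V) k = trans (ρ-linear U V _ _)
  (cong (λ e → + 3 * (U + V) + proj₁ e , + 3 * - U + proj₂ e) (ρ-orbitDigits k))

ρ^-withDigits : ∀ n u k →
                ρ^ n (withDigits u (orbitDigits k)) ≡ withDigits (ρ^ n u) (orbitDigits (iterate next n k))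
ρ^-withDigits ℕ.zero  u k = refl
ρ^-withDigits (suc n) u k = trans (cong ρ (ρ^-withDigits n u k)) (ρ-withDigits (ρ^ n u) (iterate next n k))

base : ℤ² → ℤ²
base u = withDigits u (orbitDigits (# 5))

base-injective : Injective _≡_ _≡_ base
base-injective {u} {u'} eq = proj₁ (withDigits-injective {u} {u'} {orbitDigits (# 5)} {orbitDigits (# 5)} eq)

next-cycle : ∀ k → iterate next (suc (toℕ k)) (# 5) ≡ k
next-cycle zero                                = refl
next-cycle (suc zero)                          = refl
next-cycle (suc (suc zero))                    = refl
next-cycle (suc (suc (suc zero)))              = refl
next-cycle (suc (suc (suc (suc zero))))        = refl
next-cycle (suc (suc (suc (suc (suc zero))))) = refl

ρ^-base : ∀ k u → ρ^ (suc (toℕ k)) (base u) ≡ withDigits (ρ^ (suc (toℕ k)) u) (orbitDigits k)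
ρ^-base k u = trans (ρ^-withDigits (suc (toℕ k)) u (# 5))
  (cong (withDigits (ρ^ (suc (toℕ k)) u) ∘ orbitDigits) (next-cycle k))

-- The diagonal pairs never occur (no-diagonal below); they are sent to an arbitrary index.
decode : Digit × Digit → Fin 6
decode (d⁻ , d⁺) = # 0
decode (d⁰ , d⁺) = # 1
decode (d⁺ , d⁰) = # 2
decode (d⁺ , d⁻) = # 3
decode (d⁰ , d⁻) = # 4
decode (d⁻ , d⁰) = # 5
decode (d⁻ , d⁻) = # 0
decode (d⁰ , d⁰) = # 0
decode (d⁺ , d⁺) = # 0

decode-orbitDigits : ∀ k → decode (orbitDigits k) ≡ k
decode-orbitDigits zero                                = refl
decode-orbitDigits (suc zero)                          = refl
decode-orbitDigits (suc (suc zero))                    = refl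
decode-orbitDigits (suc (suc (suc zero)))              = refl
decode-orbitDigits (suc (suc (suc (suc zero))))        = refl
decode-orbitDigits (suc (suc (suc (suc (suc zero))))) = refl

orbitDigits-injective : Injective _≡_ _≡_ orbitDigits
orbitDigits-injective {k} {k'} eq =
  trans (sym (decode-orbitDigits k)) (trans (cong decode eq) (decode-orbitDigits k'))

ρ^-base-injective : ∀ {k k' u u'} → ρ^ (suc (toℕ k)) (base u) ≡ ρ^ (suc (toℕ k')) (base u') →
                    k ≡ k' × u ≡ u'
ρ^-base-injective {k} {k'} {u} {u'} eq = k≡k' , base-injective (iterate-injective ρ-injective (suc (toℕ k)) eq')
  where
  same-digits : orbitDigits k ≡ orbitDigits k'
  same-digits = proj₂ (withDigits-injective {ρ^ (suc (toℕ k)) u} {ρ^ (suc (toℕ k')) u'}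
    {orbitDigits k} {orbitDigits k'} (trans (sym (ρ^-base k u)) (trans eq (ρ^-base k' u'))))
  k≡k' : k ≡ k'
  k≡k' = orbitDigits-injective same-digits
  eq' : ρ^ (suc (toℕ k)) (base u) ≡ ρ^ (suc (toℕ k)) (base u')
  eq' = subst (λ j → ρ^ (suc (toℕ k)) (base u) ≡ ρ^ (suc (toℕ j)) (base u')) (sym k≡k') eq

eisensteinNorm-diagonal : ∀ U V e → eisensteinNorm (+ 3 * U + e , + 3 * V + e) ≡
                + 3 * (+ 3 * (U * U + U * V + V * V) + + 3 * (U + V) * e + e * e) + + 0
eisensteinNorm-diagonal U V e = begin
  (+ 3 * U + e) * (+ 3 * U + e) + (+ 3 * U + e) * (+ 3 * V + e) + (+ 3 * V + e) * (+ 3 * V + e)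
    ≡⟨ solve (U ∷ V ∷ e ∷ []) ⟩
  + 3 * (+ 3 * (U * U + U * V + V * V) + + 3 * (U + V) * e + e * e) + + 0 ∎

no-diagonal : ∀ U V d n → eisensteinNorm (withDigits (U , V) (d , d)) ≢ + 3 * n + + 1
no-diagonal U V d n eq =
  0≢1 (proj₂ (remainder-unique 3 {X} {n} {+ 0} {+ 1} (trans (sym (eisensteinNorm-diagonal U V e)) eq) 1<3))
  where
  e : ℤ
  e = ⟦ d ⟧ᵈ
  X : ℤ
  X = + 3 * (U * U + U * V + V * V) + + 3 * (U + V) * e + e * e
  1<3 : 1 ℕ.< 3
  1<3 = ℕ.s≤s (ℕ.s≤s ℕ.z≤n)
  0≢1 : + 0 ≢ + 1
  0≢1 ()

orbitDigits-decode : ∀ u d n → eisensteinNorm (withDigits u d) ≡ + 3 * n + + 1 → orbitDigits (decode d) ≡ d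
orbitDigits-decode u (d⁻ , d⁺) n _ = refl
orbitDigits-decode u (d⁰ , d⁺) n _ = refl
orbitDigits-decode u (d⁺ , d⁰) n _ = refl
orbitDigits-decode u (d⁺ , d⁻) n _ = refl
orbitDigits-decode u (d⁰ , d⁻) n _ = refl
orbitDigits-decode u (d⁻ , d⁰) n _ = refl
orbitDigits-decode (U , V) (d⁻ , d⁻) n eq = ⊥-elim (no-diagonal U V d⁻ n eq)
orbitDigits-decode (U , V) (d⁰ , d⁰) n eq = ⊥-elim (no-diagonal U V d⁰ n eq)
orbitDigits-decode (U , V) (d⁺ , d⁺) n eq = ⊥-elim (no-diagonal U V d⁺ n eq)

ρ^-base-surjective : ∀ w n → eisensteinNorm w ≡ + 3 * n + + 1 → ∃₂ λ k u → ρ^ (suc (toℕ k)) (base u) ≡ w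
ρ^-base-surjective w n eq with withDigits-expansion w
... | u , d , refl with iterate-surjective ρ-surjective (suc (toℕ (decode d))) u
...   | u' , ρ^u'≡u = decode d , u' , (begin
  ρ^ (suc (toℕ k)) (base u')                     ≡⟨ ρ^-base k u' ⟩
  withDigits (ρ^ (suc (toℕ k)) u') (orbitDigits k) ≡⟨ cong₂ withDigits ρ^u'≡u (orbitDigits-decode u d n eq) ⟩
  withDigits u d                                 ∎)
  where
  k : Fin 6
  k = decode d

embedM : ℤ² → ℤ³
embedM (a , b) = a , b , - (a + b)

embedM-InM : ∀ u → InM (embedM u)
embedM-InM (a , b) = ℤP.+-inverseʳ (a + b)

InM⇒embedM : ∀ q → InM q → ∃ λ u → q ≡ embedM u
InM⇒embedM (a , b , c) sum≡0 = (a , b) , cong (λ t → a , b , t) (begin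
  c                       ≡⟨ solve (a ∷ b ∷ c ∷ []) ⟩
  (a + b + c) - (a + b)   ≡⟨ cong (_- (a + b)) sum≡0 ⟩
  + 0 - (a + b)           ≡⟨ ℤP.+-identityˡ (- (a + b)) ⟩
  - (a + b)               ∎)

eisensteinNorm-base : ∀ u → eisensteinNorm (base u) ≡ + 3 * atomicLength (embedM u) + + 1
eisensteinNorm-base (a , b) = begin
  (+ 3 * a - + 1) * (+ 3 * a - + 1) + (+ 3 * a - + 1) * (+ 3 * b + + 0) + (+ 3 * b + + 0) * (+ 3 * b + + 0)
    ≡⟨ solve (a ∷ b ∷ []) ⟩
  + 3 * (+ 3 * (a * a + b * b + a * b) - + 2 * a - b) + + 1 ∎

scale-shift : ∀ n r z m → ι (+ n) ℚ.* r ≡ ι m → ι (+ n) ℚ.* (r ℚ.+ ι z) ≡ ι (m + + n * z)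
scale-shift n r z m nr≡m = begin
  ι (+ n) ℚ.* (r ℚ.+ ι z)              ≡⟨ ℚP.*-distribˡ-+ (ι (+ n)) r (ι z) ⟩
  ι (+ n) ℚ.* r ℚ.+ ι (+ n) ℚ.* ι z    ≡⟨ cong₂ ℚ._+_ nr≡m (sym (ι-homo-* (+ n) z)) ⟩
  ι m ℚ.+ ι (+ n * z)                  ≡⟨ sym (ι-homo-+ m (+ n * z)) ⟩
  ι (m + + n * z)                      ∎

p-lattice : ∀ v y k → ι (+ 3) ℚ.* proj₁ v ≡ ι (y + + 1) → ι (+ 6) ℚ.* proj₁ (proj₂ v) ≡ ι (+ 2 * k) →
            p v ≡ ι² (lattice (y , k))
p-lattice (X , Y , Z) y k 3X≡ 6Y≡ = cong₂ _,_
  (begin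
    ι (+ 3) ℚ.* X ℚ.+ ι (+ 6) ℚ.* Y ℚ.- ℚ.1ℚ  ≡⟨ cong₂ (λ s t → s ℚ.+ t ℚ.- ℚ.1ℚ) 3X≡ 6Y≡ ⟩
    ι (y + + 1) ℚ.+ ι (+ 2 * k) ℚ.- ι (+ 1)   ≡⟨ cong (ℚ._- ι (+ 1)) (sym (ι-homo-+ (y + + 1) (+ 2 * k))) ⟩
    ι (y + + 1 + + 2 * k) ℚ.- ι (+ 1)         ≡⟨ sym (ι-homo-sub (y + + 1 + + 2 * k) (+ 1)) ⟩
    ι (y + + 1 + + 2 * k - + 1)               ≡⟨ cong ι first ⟩
    ι (y + + 2 * k)                           ∎)
  (begin
    ι (+ 3) ℚ.* X ℚ.- ℚ.1ℚ                    ≡⟨ cong (ℚ._- ℚ.1ℚ) 3X≡ ⟩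
    ι (y + + 1) ℚ.- ι (+ 1)                   ≡⟨ sym (ι-homo-sub (y + + 1) (+ 1)) ⟩
    ι (y + + 1 - + 1)                         ≡⟨ cong ι second ⟩
    ι y                                       ∎)
  where
  first : y + + 1 + + 2 * k - + 1 ≡ y + + 2 * k
  first = solve (y ∷ k ∷ [])
  second : y + + 1 - + 1 ≡ y
  second = solve (y ∷ [])

p-base : ∀ u → p (ι³ (embedM u)) ≡ ι² (lattice (base u))
p-base (a , b) = p-lattice (ι³ (embedM (a , b))) (+ 3 * a - + 1) (+ 3 * b + + 0)
  (trans (sym (ι-homo-* (+ 3) a)) (cong ι 3a≡))
  (trans (sym (ι-homo-* (+ 6) b)) (cong ι 6b≡))
  where
  3a≡ : + 3 * a ≡ + 3 * a - + 1 + + 1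
  3a≡ = solve (a ∷ [])
  6b≡ : + 6 * b ≡ + 2 * (+ 3 * b + + 0)
  6b≡ = solve (b ∷ [])

P₀≡p : ∀ u → P zero (embedM u) ≡ p (ι³ (embedM u))
P₀≡p (a , b) =
  cong p (cong₂ _,_ (ℚP.+-identityˡ (ι a)) (cong₂ _,_ (ℚP.+-identityˡ (ι b)) (ℚP.+-identityˡ (ι (- (a + b))))))

P₁-lattice : ∀ a b → P (# 1) (embedM (a , b)) ≡ ι² (lattice (withDigits (- (a + b) , a) (orbitDigits (# 3))))
P₁-lattice a b = p-lattice (ω (# 1) +³ Mmap (# 1) (ι³ (embedM (a , b)))) (+ 3 * - (a + b) + + 1) (+ 3 * a - + 1)
  (trans (scale-shift 3 (+ 2 ℚ./ 3) (- (a + b)) (+ 2) refl) (cong ι first))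
  (trans (scale-shift 6 (ℚ.- (+ 1 ℚ./ 3)) a -[1+ 1 ] refl) (cong ι second))
  where
  first : + 2 + + 3 * - (a + b) ≡ + 3 * - (a + b) + + 1 + + 1
  first = solve (a ∷ b ∷ [])
  second : -[1+ 1 ] + + 6 * a ≡ + 2 * (+ 3 * a - + 1)
  second = solve (a ∷ [])

P₂-lattice : ∀ a b → P (# 2) (embedM (a , b)) ≡ ι² (lattice (withDigits (b , - (a + b)) (orbitDigits (# 1))))
P₂-lattice a b = p-lattice (ω (# 2) +³ Mmap (# 2) (ι³ (embedM (a , b)))) (+ 3 * b + + 0) (+ 3 * - (a + b) + + 1)
  (trans (scale-shift 3 (+ 1 ℚ./ 3) b (+ 1) refl) (cong ι first))
  (trans (scale-shift 6 (+ 1 ℚ./ 3) (- (a + b)) (+ 2) refl) (cong ι second))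
  where
  first : + 1 + + 3 * b ≡ + 3 * b + + 0 + + 1
  first = solve (b ∷ [])
  second : + 2 + + 6 * - (a + b) ≡ + 2 * (+ 3 * - (a + b) + + 1)
  second = solve (a ∷ b ∷ [])

-- The R-orbit of p(q)

orbit : ℕ → ℤ² → ℚ²
orbit n u = Rpow n (p (ι³ (embedM u)))

orbit-lattice : ∀ n u → orbit n u ≡ ι² (lattice (ρ^ n (base u)))
orbit-lattice n u = trans (cong (Rpow n) (p-base u)) (Rpow-lattice n (base u))

orbit-digits : ∀ k u {w} → ρ^ (suc (toℕ k)) u ≡ w →
               orbit (suc (toℕ k)) u ≡ ι² (lattice (withDigits w (orbitDigits k)))
orbit-digits k u refl = trans (orbit-lattice (suc (toℕ k)) u) (cong (ι² ∘ lattice) (ρ^-base k u))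

orbit-periodic : ∀ n u → orbit (n ℕ.+ 6) u ≡ orbit n u
orbit-periodic n u = begin
  orbit (n ℕ.+ 6) u                        ≡⟨ orbit-lattice (n ℕ.+ 6) u ⟩
  ι² (lattice (ρ^ (n ℕ.+ 6) (base u)))    ≡⟨ cong (ι² ∘ lattice) (ρ^-periodic n (base u)) ⟩
  ι² (lattice (ρ^ n (base u)))            ≡⟨ sym (orbit-lattice n u) ⟩
  orbit n u                               ∎

orbit-neg : ∀ n u → neg² (orbit n u) ≡ orbit (3 ℕ.+ n) u
orbit-neg n u = begin
  neg² (orbit n u)                         ≡⟨ cong neg² (orbit-lattice n u) ⟩
  neg² (ι² (lattice (ρ^ n (base u))))     ≡⟨ neg²-lattice (ρ^ n (base u)) ⟩
  ι² (lattice (ρ^ (3 ℕ.+ n) (base u)))    ≡⟨ sym (orbit-lattice (3 ℕ.+ n) u) ⟩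
  orbit (3 ℕ.+ n) u                        ∎

orbit-injective : ∀ {k k' u u'} → orbit (suc (toℕ k)) u ≡ orbit (suc (toℕ k')) u' → k ≡ k' × u ≡ u'
orbit-injective {k} {k'} {u} {u'} eq = ρ^-base-injective (lattice-injective (ι²-injective
  (trans (sym (orbit-lattice (suc (toℕ k)) u)) (trans eq (orbit-lattice (suc (toℕ k')) u')))))

P-orbit : ∀ i u → P i (embedM u) ≡ orbit (6 ℕ.∸ 2 ℕ.* toℕ i) u
P-orbit zero             u       = trans (P₀≡p u) (sym (orbit-periodic 0 u))
P-orbit (suc zero)       (a , b) = trans (P₁-lattice a b) (sym (orbit-digits (# 3) (a , b) (ρ⁴-closed a b)))
P-orbit (suc (suc zero)) (a , b) = trans (P₂-lattice a b) (sym (orbit-digits (# 1) (a , b) (ρ²-closed a b)))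

neg-P-orbit : ∀ i u → neg² (P i (embedM u)) ≡ orbit (3 ℕ.+ (6 ℕ.∸ 2 ℕ.* toℕ i)) u
neg-P-orbit i u = trans (cong neg² (P-orbit i u)) (orbit-neg (6 ℕ.∸ 2 ℕ.* toℕ i) u)

-- R^n p(q) = (-1)^n p(ω_(n mod 3) + M_(n mod 3)(q)).
pairIndex : Fin 6 → Fin 3
pairIndex k = suc (toℕ k) mod 3

pairs⊆orbit : ∀ i u {v} → InPair (P i (embedM u)) v → ∃[ k ] (pairIndex k ≡ i × v ≡ orbit (suc (toℕ k)) u)
pairs⊆orbit zero             u (inj₁ v≡) = # 5 , refl , trans v≡ (P-orbit (# 0) u)
pairs⊆orbit zero             u (inj₂ v≡) = # 2 , refl , trans v≡ (trans (neg-P-orbit (# 0) u) (orbit-periodic 3 u))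
pairs⊆orbit (suc zero)       u (inj₁ v≡) = # 3 , refl , trans v≡ (P-orbit (# 1) u)
pairs⊆orbit (suc zero)       u (inj₂ v≡) = # 0 , refl , trans v≡ (trans (neg-P-orbit (# 1) u) (orbit-periodic 1 u))
pairs⊆orbit (suc (suc zero)) u (inj₁ v≡) = # 1 , refl , trans v≡ (P-orbit (# 2) u)
pairs⊆orbit (suc (suc zero)) u (inj₂ v≡) = # 4 , refl , trans v≡ (neg-P-orbit (# 2) u)

orbit⊆pairs : ∀ k u → InPair (P (pairIndex k) (embedM u)) (orbit (suc (toℕ k)) u)
orbit⊆pairs zero                                u = inj₂ (sym (trans (neg-P-orbit (# 1) u) (orbit-periodic 1 u)))
orbit⊆pairs (suc zero)                          u = inj₁ (sym (P-orbit (# 2) u))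
orbit⊆pairs (suc (suc zero))                    u = inj₂ (sym (trans (neg-P-orbit (# 0) u) (orbit-periodic 3 u)))
orbit⊆pairs (suc (suc (suc zero)))              u = inj₁ (sym (P-orbit (# 1) u))
orbit⊆pairs (suc (suc (suc (suc zero))))        u = inj₂ (sym (neg-P-orbit (# 2) u))
orbit⊆pairs (suc (suc (suc (suc (suc zero))))) u = inj₁ (sym (P-orbit (# 0) u))

pairs-disjoint : ∀ {i j u u' v} → InPair (P i (embedM u)) v → InPair (P j (embedM u')) v → i ≡ j × u ≡ u'
pairs-disjoint {i} {j} {u} {u'} v∈i v∈j =
  let (k , k↦i , v≡) = pairs⊆orbit i u v∈i
      (k' , k'↦j , v≡') = pairs⊆orbit j u' v∈j
      (k≡k' , u≡u') = orbit-injective {k} {k'} {u} {u'} (trans (sym v≡) v≡')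
  in trans (sym k↦i) (trans (cong pairIndex k≡k') k'↦j) , u≡u'

pairs-disjointᴹ : ∀ {i j r s v} → InM r → InM s → InPair (P i r) v → InPair (P j s) v → i ≡ j × r ≡ s
pairs-disjointᴹ {r = r} {s} r∈M s∈M v∈i v∈j with InM⇒embedM r r∈M | InM⇒embedM s s∈M
... | u , refl | u' , refl = let (i≡j , u≡u') = pairs-disjoint v∈i v∈j in i≡j , cong embedM u≡u'

-- Solutions of x² + 3y² = 12N + 4

12N+4≡4[3N+1] : ∀ N → + (12 ℕ.* N ℕ.+ 4) ≡ + 4 * (+ 3 * + N + + 1)
12N+4≡4[3N+1] N = begin
  + (12 ℕ.* N ℕ.+ 4)      ≡⟨ ℤP.pos-+ (12 ℕ.* N) 4 ⟩
  + (12 ℕ.* N) + + 4      ≡⟨ cong (_+ + 4) (ℤP.pos-* 12 N) ⟩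
  + 12 * + N + + 4        ≡⟨ factor (+ N) ⟩
  + 4 * (+ 3 * + N + + 1) ∎
  where
  factor : ∀ n → + 12 * n + + 4 ≡ + 4 * (+ 3 * n + + 1)
  factor n = solve (n ∷ [])

orbit-norm : ∀ n u → norm (lattice (ρ^ n (base u))) ≡ + 4 * (+ 3 * atomicLength (embedM u) + + 1)
orbit-norm n u = begin
  norm (lattice (ρ^ n (base u)))                   ≡⟨ norm-lattice (ρ^ n (base u)) ⟩
  + 4 * eisensteinNorm (ρ^ n (base u))             ≡⟨ cong (+ 4 *_) (eisensteinNorm-ρ^ n (base u)) ⟩
  + 4 * eisensteinNorm (base u)                    ≡⟨ cong (+ 4 *_) (eisensteinNorm-base u) ⟩
  + 4 * (+ 3 * atomicLength (embedM u) + + 1)      ∎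

pair⊆U : ∀ N i r → InM r → atomicLength r ≡ + N → ∀ {v} → InPair (P i r) v →
         ∃[ xy ] (InU (12 ℕ.* N ℕ.+ 4) xy × v ≡ ι² xy)
pair⊆U N i r r∈M ℓ≡N v∈ with InM⇒embedM r r∈M
... | u , refl =
  let (k , _ , v≡) = pairs⊆orbit i u v∈
      n = suc (toℕ k)
  in lattice (ρ^ n (base u)) ,
     trans (orbit-norm n u) (trans (cong (λ t → + 4 * (+ 3 * t + + 1)) ℓ≡N) (sym (12N+4≡4[3N+1] N))) ,
     trans v≡ (orbit-lattice n u)

-- x² + 3y² ≡ x - y (mod 2)
even-norm⇒lattice : ∀ x y m → norm (x , y) ≡ + 2 * m → ∃ λ w → lattice w ≡ (x , y)
even-norm⇒lattice x y m even with parityExpansion (x - y)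
... | k , inj₁ x-y≡2k = (y , k) , cong (_, y) (sym (begin
  x                ≡⟨ solve (x ∷ y ∷ []) ⟩
  (x - y) + y      ≡⟨ cong (_+ y) x-y≡2k ⟩
  + 2 * k + y      ≡⟨ ℤP.+-comm (+ 2 * k) y ⟩
  y + + 2 * k      ∎))
... | k , inj₂ x-y≡2k+1 = ⊥-elim (1≢0 (proj₂ (remainder-unique 2 {W} {m} {+ 1} {+ 0} odd ℕP.≤-refl)))
  where
  W : ℤ
  W = + 2 * (k * k) + + 2 * k + + 2 * (k * y) + y + + 2 * (y * y)
  x≡ : x ≡ + 2 * k + + 1 + y
  x≡ = begin
    x                    ≡⟨ solve (x ∷ y ∷ []) ⟩
    (x - y) + y          ≡⟨ cong (_+ y) x-y≡2k+1 ⟩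
    + 2 * k + + 1 + y    ∎
  odd : + 2 * W + + 1 ≡ + 2 * m + + 0
  odd = begin
    + 2 * (+ 2 * (k * k) + + 2 * k + + 2 * (k * y) + y + + 2 * (y * y)) + + 1
                                                                  ≡⟨ solve (k ∷ y ∷ []) ⟩
    (+ 2 * k + + 1 + y) * (+ 2 * k + + 1 + y) + + 3 * (y * y)     ≡⟨ cong (λ t → t * t + + 3 * (y * y)) (sym x≡) ⟩
    x * x + + 3 * (y * y)                                         ≡⟨ even ⟩
    + 2 * m                                                       ≡⟨ sym (ℤP.+-identityʳ (+ 2 * m)) ⟩
    + 2 * m + + 0                                                 ∎
  1≢0 : + 1 ≢ + 0
  1≢0 ()

U⊆pairs : ∀ N xy → InU (12 ℕ.* N ℕ.+ 4) xy →
          ∃[ i ] ∃[ r ] (InM r × atomicLength r ≡ + N × InPair (P i r) (ι² xy))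
U⊆pairs N (x , y) xy∈U with even-norm⇒lattice x y (+ 2 * (+ 3 * + N + + 1)) even
  where
  even : norm (x , y) ≡ + 2 * (+ 2 * (+ 3 * + N + + 1))
  even = trans xy∈U (trans (12N+4≡4[3N+1] N) (ℤP.*-assoc (+ 2) (+ 2) (+ 3 * + N + + 1)))
... | w , refl with ρ^-base-surjective w (+ N) eisensteinNorm≡
  where
  eisensteinNorm≡ : eisensteinNorm w ≡ + 3 * + N + + 1
  eisensteinNorm≡ = ℤP.*-cancelˡ-≡ (+ 4) _ _ (trans (sym (norm-lattice w)) (trans xy∈U (12N+4≡4[3N+1] N)))
... | k , u , refl = pairIndex k , embedM u , embedM-InM u , ℓ≡N ,
                     subst (InPair (P (pairIndex k) (embedM u))) (orbit-lattice (suc (toℕ k)) u) (orbit⊆pairs k u)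
  where
  ℓ≡N : atomicLength (embedM u) ≡ + N
  ℓ≡N = proj₁ (remainder-unique 3 {atomicLength (embedM u)} {+ N} {+ 1} {+ 1}
    (ℤP.*-cancelˡ-≡ (+ 4) _ _ (trans (sym (orbit-norm (suc (toℕ k)) u)) (trans xy∈U (12N+4≡4[3N+1] N)))) ℕ.z<s)

theorem8p6 : (N : ℕ) (q : ℤ³) → InM q → atomicLength q ≡ + N →
    ((v : ℚ²) →
      ((∃[ k ] (v ≡ Rpow (suc (toℕ {6} k)) (p (ι³ q))))
        → ∃[ i ] InPair (P i q) v)
      × (∃[ i ] InPair (P i q) v
        → ∃[ k ] (v ≡ Rpow (suc (toℕ {6} k)) (p (ι³ q)))))
    × ((i j : Fin 3) → i ≢ j → (v : ℚ²) → InPair (P i q) v → ¬ InPair (P j q) v)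
    × ((xy : ℤ × ℤ) → InU (12 ℕ.* N ℕ.+ 4) xy →
        ∃[ i ] ∃[ r ] (InM r × atomicLength r ≡ + N × InPair (P i r) (ι² xy)))
    × ((i : Fin 3) (r : ℤ³) → InM r → atomicLength r ≡ + N → (v : ℚ²) → InPair (P i r) v →
        ∃[ xy ] (InU (12 ℕ.* N ℕ.+ 4) xy × v ≡ ι² xy))
    × ((i j : Fin 3) (r s : ℤ³) → InM r → atomicLength r ≡ + N → InM s → atomicLength s ≡ + N →
        ¬ ((i ≡ j) × (r ≡ s)) → (v : ℚ²) → InPair (P i r) v → ¬ InPair (P j s) v)
-- The length of q is irrelevant: part (1) holds for every q ∈ M.
theorem8p6 N q q∈M _ with InM⇒embedM q q∈M
... | u , refl =
    (λ v → (λ (k , v≡) → pairIndex k , subst (InPair (P (pairIndex k) q)) (sym v≡) (orbit⊆pairs k u))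
         , (λ (i , v∈) → let (k , _ , v≡) = pairs⊆orbit i u v∈ in k , v≡))
  , (λ i j i≢j v v∈i v∈j → i≢j (proj₁ (pairs-disjoint {u = u} {u} v∈i v∈j)))
  , U⊆pairs N
  , (λ i r r∈M ℓ≡N v → pair⊆U N i r r∈M ℓ≡N)
  , (λ i j r s r∈M _ s∈M _ different v v∈i v∈j → different (pairs-disjointᴹ r∈M s∈M v∈i v∈j))
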